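{- Let $\Gamma,\Delta$ be finite multisets and $\chi$ a formula. If $\pi$ is a proof of $\Gamma\Rightarrow\Delta,\chi$ and $\tau$ is a proof of $\chi,\Gamma\Rightarrow\Delta$ in $\mathsf{G}^\infty+\mathrm{Cut}$, both locally cut-free, then there is a locally cut-free proof of $\Gamma\Rightarrow\Delta$ in $\mathsf{G}^\infty+\mathrm{Cut}$.
   Context: Formulas: $\phi ::= p \mid \bot \mid \phi\to\phi \mid \phi\rhd\phi$. A sequent $\Gamma\Rightarrow\Delta$ is a pair of finite multisets of formulas; commas denote multiset union; $\Sigma\rhd\bot := \{\sigma\rhd\bot:\sigma\in\Sigma\}$; for formulas $\phi_0,\dots,\phi_{m-1}$, $\Phi_{[0,i)} := \{\phi_0,\dots,\phi_{i-1}\}$. Rules: (ax) $p,\Gamma\Rightarrow p,\Delta$ for a variable $p$; ($\bot$L) $\bot,\Gamma\Rightarrow\Delta$; ($\bot$R) from $\Gamma\Rightarrow\Delta$ infer $\Gamma\Rightarrow\bot,\Delta$; ($\to$L) from $\Gamma\Rightarrow\Delta,\phi$ and $\psi,\Gamma\Rightarrow\Delta$ infer $\phi\to\psi,\Gamma\Rightarrow\Delta$; ($\to$R) from $\phi,\Gamma\Rightarrow\Delta,\psi$ infer $\Gamma\Rightarrow\Delta,\phi\to\psi$; ($\rhd_{\mathsf{IK4}}$) for $m\ge0$: from the premises $\psi_i,(\Phi_{[0,i)},\phi)\rhd\bot\Rightarrow\Phi_{[0,i)},\phi$ ($i=0,\dots,m$) infer $\phi_0\rhd\psi_0,\dots,\phi_{m-1}\rhd\psi_{m-1},\Gamma\Rightarrow\psi_m\rhd\phi,\Delta$;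 (Cut) from $\Gamma\Rightarrow\Delta,\chi$ and $\chi,\Gamma\Rightarrow\Delta$ infer $\Gamma\Rightarrow\Delta$. $\mathsf{G}^\infty+\mathrm{Cut}$: a proof is a possibly infinite, finitely branching tree whose nodes are labelled with sequents and rules among ax, $\bot$L, $\bot$R, $\to$L, $\to$R, $\rhd_{\mathsf{IK4}}$, Cut, such that each node with its children is an instance of the node's rule (leaves are ax or $\bot$L), and every infinite branch passes infinitely often from the conclusion of a $\rhd_{\mathsf{IK4}}$ instance to one of its premises (such a step is called progress). The main local fragment of a proof is the set of nodes $v$ such that the path from the root to $v$ contains no progress step. A proof is locally cut-free if no node of its main local fragment is labelled with Cut. -}

module Defs where

open import Data.Nat as ℕ using (ℕ; suc)
import Data.Fin as Fin
open import Data.Fin using (Fin; toℕ)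
open import Data.List using (List; []; _∷_; _++_; map; take)
open import Data.Vec.Functional using (Vector; toList)
open import Data.Unit using (⊤)
open import Data.Empty using (⊥)
open import Data.Product using (_×_)
open import Data.List.Relation.Binary.Permutation.Propositional using (_↭_)

data Fm : Set where
  var  : ℕ → Fm
  bot  : Fm
  _⇒ᶠ_ : Fm → Fm → Fm
  _▷_  : Fm → Fm → Fm

-- Multisets are represented as lists; every rule's conclusion is matched
-- only up to permutation (_↭_), so sequents are effectively pairs of multisets.
Ctx : Set
Ctx = List Fm

_▷⊥ : Ctx → Ctx
Σ ▷⊥ = map (λ σ → σ ▷ bot) Σ

prefix : {m : ℕ} → Vector Fm m → ℕ → Ctx
prefix φs i = take i (toList φs)

snoc : {m : ℕ} → Vector Fm m → Fm → Vector Fm (suc m)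
snoc {ℕ.zero}  ψs ψm _           = ψm
snoc {suc m}   ψs ψm Fin.zero    = ψs Fin.zero
snoc {suc m}   ψs ψm (Fin.suc i) = snoc (λ j → ψs (Fin.suc j)) ψm i

boxes : {m : ℕ} → Vector Fm m → Vector Fm m → Ctx
boxes φs ψs = toList (λ i → φs i ▷ ψs i)

-- A proof is a non-wellfounded, finitely branching tree in
-- which every infinite branch passes infinitely often through a progress step
-- (conclusion of ▷_IK4 to one of its premises), i.e. the greatest fixed point
-- ν X. μ Y. F(X,Y).

-- Local S Γ Δ : well-founded derivations of Γ ⇒ Δ in which the premises of
-- ▷_IK4 are given by S.  Sequents are lists matched up to permutation (↭).
data Local (S : Ctx → Ctx → Set) (Γ Δ : Ctx) : Set where
  ax   : (p : ℕ) (Γ' Δ' : Ctx) → Γ ↭ (var p ∷ Γ') → Δ ↭ (var p ∷ Δ') → Local S Γ Δ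
  botL : (Γ' : Ctx) → Γ ↭ (bot ∷ Γ') → Local S Γ Δ
  botR : (Δ' : Ctx) → Δ ↭ (bot ∷ Δ') → Local S Γ Δ' → Local S Γ Δ
  impL : (φ ψ : Fm) (Γ' : Ctx) → Γ ↭ ((φ ⇒ᶠ ψ) ∷ Γ') →
         Local S Γ' (Δ ++ φ ∷ []) → Local S (ψ ∷ Γ') Δ → Local S Γ Δ
  impR : (φ ψ : Fm) (Δ' : Ctx) → Δ ↭ ((φ ⇒ᶠ ψ) ∷ Δ') →
         Local S (φ ∷ Γ) (Δ' ++ ψ ∷ []) → Local S Γ Δ
  rhd  : (m : ℕ) (φs ψs : Vector Fm m) (ψm φ : Fm) (Γ' Δ' : Ctx) →
         Γ ↭ (boxes φs ψs ++ Γ') → Δ ↭ ((ψm ▷ φ) ∷ Δ') →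
         ((i : Fin (suc m)) →
            S (snoc ψs ψm i ∷ ((prefix φs (toℕ i) ++ φ ∷ []) ▷⊥))
              (prefix φs (toℕ i) ++ φ ∷ [])) →
         Local S Γ Δ
  cut  : (χ : Fm) → Local S Γ (Δ ++ χ ∷ []) → Local S (χ ∷ Γ) Δ → Local S Γ Δ

-- A proof of Γ ⇒ Δ in G^∞ + Cut: a coalgebra (S, unfold) and a state of type Γ ⇒ Δ.
record Proof (Γ Δ : Ctx) : Set₁ where
  field
    State  : Ctx → Ctx → Set
    unfold : {Γ₀ Δ₀ : Ctx} → State Γ₀ Δ₀ → Local State Γ₀ Δ₀
    start  : State Γ Δ

open Proof public

-- The main local fragment of a proof (nodes reached without a progress step).
mainLocal : {Γ Δ : Ctx} (π : Proof Γ Δ) → Local (State π) Γ Δ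
mainLocal π = unfold π (start π)

LocalCutFreeL : {S : Ctx → Ctx → Set} {Γ Δ : Ctx} → Local S Γ Δ → Set
LocalCutFreeL (ax _ _ _ _ _)            = ⊤
LocalCutFreeL (botL _ _)                = ⊤
LocalCutFreeL (botR _ _ d)              = LocalCutFreeL d
LocalCutFreeL (impL _ _ _ _ d e)        = LocalCutFreeL d × LocalCutFreeL e
LocalCutFreeL (impR _ _ _ _ d)          = LocalCutFreeL d
LocalCutFreeL (rhd _ _ _ _ _ _ _ _ _ _) = ⊤
LocalCutFreeL (cut _ _ _)               = ⊥

LocalCutFree : {Γ Δ : Ctx} → Proof Γ Δ → Set
LocalCutFree π = LocalCutFreeL (mainLocal π)

{-# OPTIONS --safe #-}
module Submission where

-- Only the main local fragment has to be cut-free, and it is a well-founded derivation, so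
-- the cut is eliminated there by the usual local reductions: by induction on the cut formula
-- and then on the left derivation, inverting the right one. The one new case is a cut on
-- a ▷ b introduced by ▷_IK4 on both sides. The two instances are merged into a single one,
-- in which the premise belonging to the box a ▷ b is replaced by the premises of the left
-- instance, glued in by cuts on b and on a. These cuts lie above a progress step, where cuts
-- are allowed, so they simply stay. A cut on b inside a premise needs b ▷ ⊥ in the
-- antecedent, and ▷_IK4 with the boxes X ▷ ⊥ derives it from the premise b, X ▷ ⊥ ⇒ X.

open import Defs
open import Data.Nat as ℕ using (ℕ; zero; suc)
open import Data.Fin using (Fin; zero; suc; toℕ)
open import Data.List using (List; []; _∷_; _++_; map; length)
open import Data.List.Properties using (++-assoc; ++-identityʳ; map-++; map-∘; map-tabulate)
import Data.Vec.Functional as Vec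
open import Data.Vec.Functional using (Vector; toList; fromList; zip)
open import Data.Vec.Functional.Properties using (toList∘fromList)
open import Data.Unit using (⊤; tt)
open import Data.Empty using (⊥; ⊥-elim)
open import Data.Product using (Σ; ∃; ∃₂; _×_; _,_; proj₁; proj₂; uncurry)
open import Data.Sum using (_⊎_; inj₁; inj₂)
open import Function using (_∘_)
open import Relation.Nullary using (yes; no)
open import Relation.Nullary.Decidable using (map′; _×-dec_)
open import Relation.Binary.Definitions using (DecidableEquality; _Respects_)
open import Relation.Binary.PropositionalEquality using (_≡_; _≢_; refl; sym; trans; cong; subst)
open import Data.List.Relation.Unary.Any using (here; there)
import Data.List.Relation.Unary.Any as Any
import Data.List.Relation.Unary.All as All
open import Data.List.Relation.Unary.AllPairs using ([]; _∷_)
open import Data.List.Relation.Unary.Unique.Propositional using (Unique)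
import Data.List.Relation.Unary.Unique.Propositional.Properties as Unique
open import Data.List.Membership.Propositional using (_∈_; _∉_)
open import Data.List.Membership.Propositional.Properties
  using (∈-∃++; ∈-++⁻; ∈-++⁺ʳ; ∈-map⁻)
open import Data.List.Relation.Binary.Subset.Propositional using (_⊆_)
open import Data.List.Relation.Binary.Subset.Propositional.Properties
  using (⊆-refl; ⊆-trans; ⊆-reflexive; ⊆-reflexive-↭; map⁺; xs⊆x∷xs; ∷⁺ʳ; ∈-∷⁺ʳ;
         xs⊆xs++ys; xs⊆ys++xs)
open import Data.List.Relation.Binary.Permutation.Propositional
  using (_↭_; refl; prep; swap; ↭-sym; ↭-trans; ↭-reflexive; module PermutationReasoning)
open import Data.List.Relation.Binary.Permutation.Propositional.Properties
  using (∈-resp-↭; ++⁺ˡ; ++⁺ʳ; shift; drop-∷; ∷↭∷ʳ)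

private
  variable
    A : Set
    x y : A
    xs ys zs : List A

infixr 5 _⨾_
_⨾_ : xs ↭ ys → ys ↭ zs → xs ↭ zs
_⨾_ = ↭-trans

∈⇒↭ : x ∈ xs → ∃ λ ys → xs ↭ x ∷ ys
∈⇒↭ x∈xs with ys , zs , refl ← ∈-∃++ x∈xs = ys ++ zs , shift _ ys zs

↭∷⇒∈ : xs ↭ x ∷ ys → x ∈ xs
↭∷⇒∈ p = ∈-resp-↭ (↭-sym p) (here refl)

∷↭∷⁻ : x ∷ xs ↭ y ∷ ys → (x ≡ y × xs ↭ ys) ⊎ ∃ λ zs → ys ↭ x ∷ zs × xs ↭ y ∷ zs
∷↭∷⁻ {x = x} {y = y} p with ∈-resp-↭ p (here refl)
... | here refl = inj₁ (refl , drop-∷ p)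
... | there x∈ys with zs , q ← ∈⇒↭ x∈ys =
  inj₂ (zs , q , drop-∷ (p ⨾ prep y q ⨾ swap y x refl))

∷↭∷⁻-≢ : x ≢ y → x ∷ xs ↭ y ∷ ys → ∃ λ zs → ys ↭ x ∷ zs × xs ↭ y ∷ zs
∷↭∷⁻-≢ x≢y p with ∷↭∷⁻ p
... | inj₁ (x≡y , _) = ⊥-elim (x≢y x≡y)
... | inj₂ r         = r

++↭∷⁻ : ∀ xs → x ∉ xs → xs ++ ys ↭ x ∷ zs → ∃ λ ys′ → ys ↭ x ∷ ys′ × zs ↭ xs ++ ys′
++↭∷⁻ {x = x} xs x∉xs p with ∈-++⁻ xs (↭∷⇒∈ p)
... | inj₁ x∈xs = ⊥-elim (x∉xs x∈xs)
... | inj₂ x∈ys with ys′ , q ← ∈⇒↭ x∈ys =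
  ys′ , q , ↭-sym (drop-∷ (↭-sym (shift x xs ys′) ⨾ ↭-sym (++⁺ˡ xs q) ⨾ p))

++[]↭∷ : ∀ xs (x : A) → xs ++ x ∷ [] ↭ x ∷ xs
++[]↭∷ xs x = ↭-sym (∷↭∷ʳ x xs)

∷ʳ-++-comm : ∀ xs (x : A) ys → (xs ++ x ∷ []) ++ ys ↭ (xs ++ ys) ++ x ∷ []
∷ʳ-++-comm xs x ys =
  ↭-reflexive (++-assoc xs (x ∷ []) ys) ⨾ shift x xs ys ⨾ ↭-sym (++[]↭∷ (xs ++ ys) x)

++-⊆ : xs ⊆ zs → ys ⊆ zs → xs ++ ys ⊆ zs
++-⊆ {xs = xs} xs⊆zs ys⊆zs x∈ with ∈-++⁻ xs x∈
... | inj₁ x∈xs = xs⊆zs x∈xs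
... | inj₂ x∈ys = ys⊆zs x∈ys

Unique∧⊆⇒↭++ : Unique xs → xs ⊆ ys → ∃ λ zs → ys ↭ xs ++ zs
Unique∧⊆⇒↭++ {xs = []}     []          _     = _ , refl
Unique∧⊆⇒↭++ {xs = x ∷ xs} (x∉xs ∷ u) xs⊆ys
  with ys′ , p ← ∈⇒↭ (xs⊆ys (here refl))
  with zs , q ← Unique∧⊆⇒↭++ u (λ y∈xs → Any.tail (All.lookup x∉xs y∈xs ∘ sym)
                                                  (∈-resp-↭ p (xs⊆ys (there y∈xs))))
  = zs , (p ⨾ prep x q)

_≟_ : DecidableEquality Fm
var p ≟ var q = map′ (cong var) (λ { refl → refl }) (p ℕ.≟ q)
bot ≟ bot = yes refl
(φ ⇒ᶠ ψ) ≟ (φ′ ⇒ᶠ ψ′) =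
  map′ (λ { (refl , refl) → refl }) (λ { refl → refl , refl }) (φ ≟ φ′ ×-dec ψ ≟ ψ′)
(φ ▷ ψ) ≟ (φ′ ▷ ψ′) =
  map′ (λ { (refl , refl) → refl }) (λ { refl → refl , refl }) (φ ≟ φ′ ×-dec ψ ≟ ψ′)
var _    ≟ bot      = no λ ()
var _    ≟ (_ ⇒ᶠ _) = no λ ()
var _    ≟ (_ ▷ _)  = no λ ()
bot      ≟ var _    = no λ ()
bot      ≟ (_ ⇒ᶠ _) = no λ ()
bot      ≟ (_ ▷ _)  = no λ ()
(_ ⇒ᶠ _) ≟ var _    = no λ ()
(_ ⇒ᶠ _) ≟ bot      = no λ ()
(_ ⇒ᶠ _) ≟ (_ ▷ _)  = no λ ()
(_ ▷ _)  ≟ var _    = no λ ()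
(_ ▷ _)  ≟ bot      = no λ ()
(_ ▷ _)  ≟ (_ ⇒ᶠ _) = no λ ()

open import Data.List.Membership.DecPropositional _≟_ using (_∈?_)

Box : Set
Box = Fm × Fm

boxesᴸ : List Box → Ctx
boxesᴸ = map (uncurry _▷_)

uncurry-▷-injective : ∀ {b c : Box} → uncurry _▷_ b ≡ uncurry _▷_ c → b ≡ c
uncurry-▷-injective {_ , _} {_ , _} refl = refl

IsBox : Fm → Set
IsBox (_ ▷ _) = ⊤
IsBox _       = ⊥

∈boxesᴸ⇒IsBox : ∀ L {φ} → φ ∈ boxesᴸ L → IsBox φ
∈boxesᴸ⇒IsBox L φ∈ with _ , _ , refl ← ∈-map⁻ (uncurry _▷_) φ∈ = tt

∈boxesᴸ⇒∃++ : ∀ L {a b} → a ▷ b ∈ boxesᴸ L → ∃₂ λ Lₗ Lᵣ → L ≡ Lₗ ++ (a , b) ∷ Lᵣ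
∈boxesᴸ⇒∃++ L a▷b∈ with (_ , _) , ab∈L , refl ← ∈-map⁻ (uncurry _▷_) a▷b∈ = ∈-∃++ ab∈L

boxes≡boxesᴸ-zip : ∀ {m} (φs ψs : Vector Fm m) → boxes φs ψs ≡ boxesᴸ (toList (zip φs ψs))
boxes≡boxesᴸ-zip φs ψs = sym (map-tabulate (zip φs ψs) (uncurry _▷_))

∈boxes⇒IsBox : ∀ {m} (φs ψs : Vector Fm m) {φ} → φ ∈ boxes φs ψs → IsBox φ
∈boxes⇒IsBox φs ψs φ∈ = ∈boxesᴸ⇒IsBox _ (subst (_ ∈_) (boxes≡boxesᴸ-zip φs ψs) φ∈)

φsOf ψsOf : (L : List Box) → Vector Fm (length L)
φsOf L = Vec.map proj₁ (fromList L)
ψsOf L = Vec.map proj₂ (fromList L)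

boxes-fromList : ∀ L → boxes (φsOf L) (ψsOf L) ≡ boxesᴸ L
boxes-fromList L =
  trans (sym (map-tabulate (fromList L) (uncurry _▷_))) (cong boxesᴸ (toList∘fromList L))

Fresh : Ctx → List Box → Set
Fresh X []            = ⊤
Fresh X ((φ , ψ) ∷ L) = φ ∉ X × Fresh (φ ∷ X) L

Fresh⇒∉ : ∀ {X L φ ψ} → Fresh X L → (φ , ψ) ∈ L → φ ∉ X
Fresh⇒∉ (φ∉X , _)   (here refl) = φ∉X
Fresh⇒∉ (_ , fresh) (there b∈L) = Fresh⇒∉ fresh b∈L ∘ there

Fresh⇒Unique : ∀ {X} L → Fresh X L → Unique L
Fresh⇒Unique []            _           = []
Fresh⇒Unique ((φ , ψ) ∷ L) (_ , fresh) =
  All.tabulate (λ b∈L eq → Fresh⇒∉ fresh (subst (_∈ L) (sym eq) b∈L) (here refl))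
  ∷ Fresh⇒Unique L fresh

-- a ▷ b may also occur among Lₗ or Lᵣ, so this needs multiset rather than set reasoning.
merged-boxes-⊆ : ∀ Lₗ Lₘ Lᵣ {a b Γ Γ′} → boxesᴸ Lₘ ⊆ Γ →
                 (a ▷ b) ∷ Γ ↭ boxesᴸ (Lₗ ++ (a , b) ∷ Lᵣ) ++ Γ′ →
                 boxesᴸ (Lₗ ++ Lₘ ++ Lᵣ) ⊆ Γ
merged-boxes-⊆ Lₗ Lₘ Lᵣ {a} {b} {Γ} {Γ′} Lₘ⊆Γ p =
  ++-⊆ (Γ⊇ ∘ xs⊆xs++ys (boxesᴸ Lₗ) _)
       (++-⊆ Lₘ⊆Γ (Γ⊇ ∘ xs⊆ys++xs _ (boxesᴸ Lₗ) ∘ xs⊆xs++ys (boxesᴸ Lᵣ) Γ′))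
  ∘ ⊆-reflexive split
  where
    split : boxesᴸ (Lₗ ++ Lₘ ++ Lᵣ) ≡ boxesᴸ Lₗ ++ boxesᴸ Lₘ ++ boxesᴸ Lᵣ
    split = trans (map-++ _ Lₗ _) (cong (boxesᴸ Lₗ ++_) (map-++ _ Lₘ Lᵣ))
    open PermutationReasoning
    Γ⊇ : boxesᴸ Lₗ ++ boxesᴸ Lᵣ ++ Γ′ ⊆ Γ
    Γ⊇ = ⊆-reflexive-↭ (↭-sym (drop-∷ (begin
      (a ▷ b) ∷ Γ                             ↭⟨ p ⟩
      boxesᴸ (Lₗ ++ (a , b) ∷ Lᵣ) ++ Γ′       ≡⟨ cong (_++ Γ′) (map-++ _ Lₗ _) ⟩
      (boxesᴸ Lₗ ++ (a ▷ b) ∷ boxesᴸ Lᵣ) ++ Γ′ ≡⟨ ++-assoc (boxesᴸ Lₗ) _ Γ′ ⟩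
      boxesᴸ Lₗ ++ (a ▷ b) ∷ boxesᴸ Lᵣ ++ Γ′   ↭⟨ shift (a ▷ b) (boxesᴸ Lₗ) (boxesᴸ Lᵣ ++ Γ′) ⟩
      (a ▷ b) ∷ boxesᴸ Lₗ ++ boxesᴸ Lᵣ ++ Γ′   ∎)))

private
  variable
    S T : Ctx → Ctx → Set
    Γ Γ₁ Δ Δ₁ X Y : Ctx
    φ ψ : Fm

data CutFree (S : Ctx → Ctx → Set) (Γ Δ : Ctx) : Set where
  ax   : (p : ℕ) (Γ' Δ' : Ctx) → Γ ↭ (var p ∷ Γ') → Δ ↭ (var p ∷ Δ') → CutFree S Γ Δ
  botL : (Γ' : Ctx) → Γ ↭ (bot ∷ Γ') → CutFree S Γ Δ
  botR : (Δ' : Ctx) → Δ ↭ (bot ∷ Δ') → CutFree S Γ Δ' → CutFree S Γ Δ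
  impL : (φ ψ : Fm) (Γ' : Ctx) → Γ ↭ ((φ ⇒ᶠ ψ) ∷ Γ') →
         CutFree S Γ' (Δ ++ φ ∷ []) → CutFree S (ψ ∷ Γ') Δ → CutFree S Γ Δ
  impR : (φ ψ : Fm) (Δ' : Ctx) → Δ ↭ ((φ ⇒ᶠ ψ) ∷ Δ') →
         CutFree S (φ ∷ Γ) (Δ' ++ ψ ∷ []) → CutFree S Γ Δ
  rhd  : (m : ℕ) (φs ψs : Vector Fm m) (ψm φ : Fm) (Γ' Δ' : Ctx) →
         Γ ↭ (boxes φs ψs ++ Γ') → Δ ↭ ((ψm ▷ φ) ∷ Δ') →
         ((i : Fin (suc m)) →
            S (snoc ψs ψm i ∷ ((prefix φs (toℕ i) ++ φ ∷ []) ▷⊥))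
              (prefix φs (toℕ i) ++ φ ∷ [])) →
         CutFree S Γ Δ

toLocal : CutFree S Γ Δ → Local S Γ Δ
toLocal (ax p Γ′ Δ′ g h)                  = ax p Γ′ Δ′ g h
toLocal (botL Γ′ g)                       = botL Γ′ g
toLocal (botR Δ′ h d)                     = botR Δ′ h (toLocal d)
toLocal (impL φ ψ Γ′ g d e)               = impL φ ψ Γ′ g (toLocal d) (toLocal e)
toLocal (impR φ ψ Δ′ h d)                 = impR φ ψ Δ′ h (toLocal d)
toLocal (rhd m φs ψs ψm φ Γ′ Δ′ g h prem) = rhd m φs ψs ψm φ Γ′ Δ′ g h prem

toLocal-cutFree : (d : CutFree S Γ Δ) → LocalCutFreeL (toLocal d)
toLocal-cutFree (ax _ _ _ _ _)            = tt
toLocal-cutFree (botL _ _)                = tt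
toLocal-cutFree (botR _ _ d)              = toLocal-cutFree d
toLocal-cutFree (impL _ _ _ _ d e)        = toLocal-cutFree d , toLocal-cutFree e
toLocal-cutFree (impR _ _ _ _ d)          = toLocal-cutFree d
toLocal-cutFree (rhd _ _ _ _ _ _ _ _ _ _) = tt

fromLocal : (∀ {Γ Δ} → S Γ Δ → T Γ Δ) → (d : Local S Γ Δ) → LocalCutFreeL d → CutFree T Γ Δ
fromLocal f (ax p Γ′ Δ′ g h) _                  = ax p Γ′ Δ′ g h
fromLocal f (botL Γ′ g) _                       = botL Γ′ g
fromLocal f (botR Δ′ h d) c                     = botR Δ′ h (fromLocal f d c)
fromLocal f (impL φ ψ Γ′ g d e) (c , c′)        =
  impL φ ψ Γ′ g (fromLocal f d c) (fromLocal f e c′)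
fromLocal f (impR φ ψ Δ′ h d) c                 = impR φ ψ Δ′ h (fromLocal f d c)
fromLocal f (rhd m φs ψs ψm φ Γ′ Δ′ g h prem) _ = rhd m φs ψs ψm φ Γ′ Δ′ g h (f ∘ prem)

mapLocal : (∀ {Γ Δ} → S Γ Δ → T Γ Δ) → Local S Γ Δ → Local T Γ Δ
mapLocal f (ax p Γ′ Δ′ g h)                  = ax p Γ′ Δ′ g h
mapLocal f (botL Γ′ g)                       = botL Γ′ g
mapLocal f (botR Δ′ h d)                     = botR Δ′ h (mapLocal f d)
mapLocal f (impL φ ψ Γ′ g d e)               = impL φ ψ Γ′ g (mapLocal f d) (mapLocal f e)
mapLocal f (impR φ ψ Δ′ h d)                 = impR φ ψ Δ′ h (mapLocal f d)
mapLocal f (rhd m φs ψs ψm φ Γ′ Δ′ g h prem) = rhd m φs ψs ψm φ Γ′ Δ′ g h (f ∘ prem)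
mapLocal f (cut χ d e)                       = cut χ (mapLocal f d) (mapLocal f e)

CutFree-weaken : ∀ A B → Γ ++ A ↭ Γ₁ → Δ ++ B ↭ Δ₁ → CutFree S Γ Δ → CutFree S Γ₁ Δ₁
CutFree-weaken A B pΓ pΔ (ax p Γ′ Δ′ g h) =
  ax p (Γ′ ++ A) (Δ′ ++ B) (↭-sym pΓ ⨾ ++⁺ʳ A g) (↭-sym pΔ ⨾ ++⁺ʳ B h)
CutFree-weaken A B pΓ pΔ (botL Γ′ g) = botL (Γ′ ++ A) (↭-sym pΓ ⨾ ++⁺ʳ A g)
CutFree-weaken A B pΓ pΔ (botR Δ′ h d) =
  botR (Δ′ ++ B) (↭-sym pΔ ⨾ ++⁺ʳ B h) (CutFree-weaken A B pΓ refl d)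
CutFree-weaken {Δ = Δ} A B pΓ pΔ (impL φ ψ Γ′ g d e) =
  impL φ ψ (Γ′ ++ A) (↭-sym pΓ ⨾ ++⁺ʳ A g)
    (CutFree-weaken A B refl (∷ʳ-++-comm Δ φ B ⨾ ++⁺ʳ (φ ∷ []) pΔ) d)
    (CutFree-weaken A B refl pΔ e)
CutFree-weaken A B pΓ pΔ (impR φ ψ Δ′ h d) =
  impR φ ψ (Δ′ ++ B) (↭-sym pΔ ⨾ ++⁺ʳ B h) (CutFree-weaken A B (prep φ pΓ) (∷ʳ-++-comm Δ′ ψ B) d)
CutFree-weaken A B pΓ pΔ (rhd m φs ψs ψm φ Γ′ Δ′ g h prem) =
  rhd m φs ψs ψm φ (Γ′ ++ A) (Δ′ ++ B)
    (↭-sym pΓ ⨾ ++⁺ʳ A g ⨾ ↭-reflexive (++-assoc (boxes φs ψs) Γ′ A))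
    (↭-sym pΔ ⨾ ++⁺ʳ B h) prem

CutFree-↭ : Γ ↭ Γ₁ → Δ ↭ Δ₁ → CutFree S Γ Δ → CutFree S Γ₁ Δ₁
CutFree-↭ {Γ = Γ} {Δ = Δ} p q =
  CutFree-weaken [] [] (↭-reflexive (++-identityʳ Γ) ⨾ p) (↭-reflexive (++-identityʳ Δ) ⨾ q)

Local-weaken : ∀ A B → Γ ++ A ↭ Γ₁ → Δ ++ B ↭ Δ₁ → Local S Γ Δ → Local S Γ₁ Δ₁
Local-weaken A B pΓ pΔ (ax p Γ′ Δ′ g h) =
  ax p (Γ′ ++ A) (Δ′ ++ B) (↭-sym pΓ ⨾ ++⁺ʳ A g) (↭-sym pΔ ⨾ ++⁺ʳ B h)
Local-weaken A B pΓ pΔ (botL Γ′ g) = botL (Γ′ ++ A) (↭-sym pΓ ⨾ ++⁺ʳ A g)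
Local-weaken A B pΓ pΔ (botR Δ′ h d) =
  botR (Δ′ ++ B) (↭-sym pΔ ⨾ ++⁺ʳ B h) (Local-weaken A B pΓ refl d)
Local-weaken {Δ = Δ} A B pΓ pΔ (impL φ ψ Γ′ g d e) =
  impL φ ψ (Γ′ ++ A) (↭-sym pΓ ⨾ ++⁺ʳ A g)
    (Local-weaken A B refl (∷ʳ-++-comm Δ φ B ⨾ ++⁺ʳ (φ ∷ []) pΔ) d)
    (Local-weaken A B refl pΔ e)
Local-weaken A B pΓ pΔ (impR φ ψ Δ′ h d) =
  impR φ ψ (Δ′ ++ B) (↭-sym pΔ ⨾ ++⁺ʳ B h) (Local-weaken A B (prep φ pΓ) (∷ʳ-++-comm Δ′ ψ B) d)
Local-weaken A B pΓ pΔ (rhd m φs ψs ψm φ Γ′ Δ′ g h prem) =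
  rhd m φs ψs ψm φ (Γ′ ++ A) (Δ′ ++ B)
    (↭-sym pΓ ⨾ ++⁺ʳ A g ⨾ ↭-reflexive (++-assoc (boxes φs ψs) Γ′ A))
    (↭-sym pΔ ⨾ ++⁺ʳ B h) prem
Local-weaken {Δ = Δ} A B pΓ pΔ (cut χ d e) =
  cut χ (Local-weaken A B pΓ (∷ʳ-++-comm Δ χ B ⨾ ++⁺ʳ (χ ∷ []) pΔ) d)
        (Local-weaken A B (prep χ pΓ) pΔ e)

Local-↭ : Γ ↭ Γ₁ → Δ ↭ Δ₁ → Local S Γ Δ → Local S Γ₁ Δ₁
Local-↭ {Γ = Γ} {Δ = Δ} p q =
  Local-weaken [] [] (↭-reflexive (++-identityʳ Γ) ⨾ p) (↭-reflexive (++-identityʳ Δ) ⨾ q)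

CutFree-botR⁻ : CutFree S Γ Δ → Δ ↭ bot ∷ Δ₁ → CutFree S Γ Δ₁
CutFree-botR⁻ (ax p Γ′ Δ′ g h) q with K , r , _ ← ∷↭∷⁻-≢ (λ ()) (↭-sym h ⨾ q) = ax p Γ′ K g r
CutFree-botR⁻ (botL Γ′ g) q = botL Γ′ g
CutFree-botR⁻ (botR Δ′ h d) q = CutFree-↭ refl (drop-∷ (↭-sym h ⨾ q)) d
CutFree-botR⁻ (impL φ ψ Γ′ g d e) q =
  impL φ ψ Γ′ g (CutFree-botR⁻ d (++⁺ʳ (φ ∷ []) q)) (CutFree-botR⁻ e q)
CutFree-botR⁻ (impR φ ψ Δ′ h d) q with K , r , r′ ← ∷↭∷⁻-≢ (λ ()) (↭-sym h ⨾ q) =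
  impR φ ψ K r (CutFree-botR⁻ d (++⁺ʳ (ψ ∷ []) r′))
CutFree-botR⁻ (rhd m φs ψs ψm φ Γ′ Δ′ g h prem) q
  with K , r , _ ← ∷↭∷⁻-≢ (λ ()) (↭-sym h ⨾ q) = rhd m φs ψs ψm φ Γ′ K g r prem

CutFree-impR⁻ : ∀ {a b} → CutFree S Γ Δ → Δ ↭ (a ⇒ᶠ b) ∷ Δ₁ → CutFree S (a ∷ Γ) (Δ₁ ++ b ∷ [])
CutFree-impR⁻ {a = a} {b} (ax p Γ′ Δ′ g h) q with K , r , _ ← ∷↭∷⁻-≢ (λ ()) (↭-sym h ⨾ q) =
  ax p (a ∷ Γ′) (K ++ b ∷ []) (prep a g ⨾ swap a (var p) refl) (++⁺ʳ (b ∷ []) r)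
CutFree-impR⁻ {a = a} (botL Γ′ g) q = botL (a ∷ Γ′) (prep a g ⨾ swap a bot refl)
CutFree-impR⁻ {b = b} (botR Δ′ h d) q with K , r , r′ ← ∷↭∷⁻-≢ (λ ()) (↭-sym h ⨾ q) =
  botR (K ++ b ∷ []) (++⁺ʳ (b ∷ []) r) (CutFree-impR⁻ d r′)
CutFree-impR⁻ {Δ₁ = Δ₁} {a = a} {b} (impL φ ψ Γ′ g d e) q =
  impL φ ψ (a ∷ Γ′) (prep a g ⨾ swap a _ refl)
    (CutFree-↭ refl (∷ʳ-++-comm Δ₁ φ (b ∷ [])) (CutFree-impR⁻ d (++⁺ʳ (φ ∷ []) q)))
    (CutFree-↭ (swap a ψ refl) refl (CutFree-impR⁻ e q))
CutFree-impR⁻ {a = a} {b} (impR φ ψ Δ′ h d) q with ∷↭∷⁻ (↭-sym h ⨾ q)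
... | inj₁ (refl , r) = CutFree-↭ refl (++⁺ʳ (b ∷ []) r) d
... | inj₂ (K , r , r′) =
  impR φ ψ (K ++ b ∷ []) (++⁺ʳ (b ∷ []) r)
    (CutFree-↭ (swap a φ refl) (∷ʳ-++-comm K ψ (b ∷ [])) (CutFree-impR⁻ d (++⁺ʳ (ψ ∷ []) r′)))
CutFree-impR⁻ {a = a} {b} (rhd m φs ψs ψm φ Γ′ Δ′ g h prem) q
  with K , r , _ ← ∷↭∷⁻-≢ (λ ()) (↭-sym h ⨾ q) =
  rhd m φs ψs ψm φ (a ∷ Γ′) (K ++ b ∷ [])
    (prep a g ⨾ ↭-sym (shift a (boxes φs ψs) Γ′)) (++⁺ʳ (b ∷ []) r) prem

CutFree-impL⁻ : ∀ {a b} → CutFree S Γ Δ → Γ ↭ (a ⇒ᶠ b) ∷ Γ₁ →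
                CutFree S Γ₁ (Δ ++ a ∷ []) × CutFree S (b ∷ Γ₁) Δ
CutFree-impL⁻ {a = a} {b} (ax p Γ′ Δ′ g h) q with K , r , _ ← ∷↭∷⁻-≢ (λ ()) (↭-sym g ⨾ q) =
  ax p K (Δ′ ++ a ∷ []) r (++⁺ʳ (a ∷ []) h) , ax p (b ∷ K) Δ′ (prep b r ⨾ swap b _ refl) h
CutFree-impL⁻ {b = b} (botL Γ′ g) q with K , r , _ ← ∷↭∷⁻-≢ (λ ()) (↭-sym g ⨾ q) =
  botL K r , botL (b ∷ K) (prep b r ⨾ swap b _ refl)
CutFree-impL⁻ {a = a} (botR Δ′ h d) q with d₁ , d₂ ← CutFree-impL⁻ d q =
  botR (Δ′ ++ a ∷ []) (++⁺ʳ (a ∷ []) h) d₁ , botR Δ′ h d₂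
CutFree-impL⁻ {Δ = Δ} {a = a} {b} (impL φ ψ Γ′ g d e) q with ∷↭∷⁻ (↭-sym g ⨾ q)
... | inj₁ (refl , r) = CutFree-↭ r refl d , CutFree-↭ (prep b r) refl e
... | inj₂ (K , r , r′)
  with d₁ , d₂ ← CutFree-impL⁻ d r′ | e₁ , e₂ ← CutFree-impL⁻ e (prep ψ r′ ⨾ swap ψ _ refl) =
  impL φ ψ K r (CutFree-↭ refl (∷ʳ-++-comm Δ φ (a ∷ [])) d₁) e₁ ,
  impL φ ψ (b ∷ K) (prep b r ⨾ swap b _ refl) d₂ (CutFree-↭ (swap b ψ refl) refl e₂)
CutFree-impL⁻ {a = a} {b} (impR φ ψ Δ′ h d) q
  with d₁ , d₂ ← CutFree-impL⁻ d (prep φ q ⨾ swap φ _ refl) =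
  impR φ ψ (Δ′ ++ a ∷ []) (++⁺ʳ (a ∷ []) h) (CutFree-↭ refl (∷ʳ-++-comm Δ′ ψ (a ∷ [])) d₁) ,
  impR φ ψ Δ′ h (CutFree-↭ (swap b φ refl) refl d₂)
CutFree-impL⁻ {a = a} {b} (rhd m φs ψs ψm φ Γ′ Δ′ g h prem) q
  with K , r , r′ ← ++↭∷⁻ (boxes φs ψs) (∈boxes⇒IsBox φs ψs) (↭-sym g ⨾ q) =
  rhd m φs ψs ψm φ K (Δ′ ++ a ∷ []) r′ (++⁺ʳ (a ∷ []) h) prem ,
  rhd m φs ψs ψm φ (b ∷ K) Δ′ (prep b r′ ⨾ ↭-sym (shift b (boxes φs ψs) K)) h prem

-- Cut admissibility over states that include all local derivations

module _ {S : Ctx → Ctx → Set}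
         (state : ∀ {Γ Δ} → Local S Γ Δ → S Γ Δ)
         (expand : ∀ {Γ Δ} → S Γ Δ → Local S Γ Δ) where

  Local-id : ∀ φ → Local S (φ ∷ []) (φ ∷ [])
  Local-id (var p) = ax p [] [] refl refl
  Local-id bot     = botL [] refl
  Local-id (φ ⇒ᶠ ψ) = impR φ ψ [] refl
    (impL φ ψ (φ ∷ []) (swap φ (φ ⇒ᶠ ψ) refl)
      (Local-weaken [] (ψ ∷ []) refl (swap φ ψ refl) (Local-id φ))
      (Local-weaken (φ ∷ []) [] refl refl (Local-id ψ)))
  Local-id (φ ▷ ψ) = rhd 1 (λ _ → φ) (λ _ → ψ) φ ψ [] [] refl refl λ
    { zero       → state (Local-weaken ((ψ ▷ bot) ∷ []) [] refl refl (Local-id ψ))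
    ; (suc zero) → state (Local-weaken ((φ ▷ bot) ∷ (ψ ▷ bot) ∷ []) (ψ ∷ []) refl refl
                                       (Local-id φ))
    }

  Local-axiom : φ ∈ Γ → φ ∈ Δ → Local S Γ Δ
  Local-axiom {φ} φ∈Γ φ∈Δ with Γ′ , p ← ∈⇒↭ φ∈Γ | Δ′ , q ← ∈⇒↭ φ∈Δ =
    Local-weaken Γ′ Δ′ (↭-sym p) (↭-sym q) (Local-id φ)

  Local-contractˡ : ∀ A → A ⊆ Γ → Local S (A ++ Γ) Δ → Local S Γ Δ
  Local-contractˡ []      _   d = d
  Local-contractˡ {Δ = Δ} (φ ∷ A) A⊆Γ d = Local-contractˡ A (A⊆Γ ∘ there)
    (cut φ (Local-axiom (∈-++⁺ʳ A (A⊆Γ (here refl))) (∈-++⁺ʳ Δ (here refl))) d)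

  Local-contractʳ : ∀ B → B ⊆ Δ → Local S Γ (B ++ Δ) → Local S Γ Δ
  Local-contractʳ []      _   d = d
  Local-contractʳ {Δ = Δ} (φ ∷ B) B⊆Δ d = Local-contractʳ B (B⊆Δ ∘ there)
    (cut φ (Local-↭ refl (↭-sym (++[]↭∷ (B ++ Δ) φ)) d)
           (Local-axiom (here refl) (∈-++⁺ʳ B (B⊆Δ (here refl)))))

  Local-⊆ : Γ ⊆ Γ₁ → Δ ⊆ Δ₁ → Local S Γ Δ → Local S Γ₁ Δ₁
  Local-⊆ {Γ} {Γ₁} {Δ} {Δ₁} Γ⊆ Δ⊆ =
    Local-contractʳ Δ Δ⊆ ∘ Local-contractˡ Γ Γ⊆ ∘ Local-weaken Γ₁ Δ₁ refl refl

  Premise : Fm → Ctx → Set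
  Premise ψ X = Local S (ψ ∷ X ▷⊥) X

  Premise-⊆ : Premise ψ Respects _⊆_
  Premise-⊆ X⊆Y = Local-⊆ (∷⁺ʳ _ (map⁺ _ X⊆Y)) X⊆Y

  -- The premises of ▷_IK4 with boxes L, the i-th one over the first i box antecedents
  -- prepended to X (in the rule: Φ_[0,i), φ), then K over the context reached after all of L;
  -- the continuation K lets box lists be split and spliced.
  Premises : Ctx → List Box → (Ctx → Set) → Set
  Premises X []            K = K X
  Premises X ((φ , ψ) ∷ L) K = Premise ψ X × Premises (φ ∷ X) L K

  Premises-⊆ : ∀ L {K} → K Respects _⊆_ → X ⊆ Y → Premises X L K → Premises Y L K
  Premises-⊆ []            K-⊆ X⊆Y k        = K-⊆ X⊆Y k
  Premises-⊆ ((φ , ψ) ∷ L) K-⊆ X⊆Y (p , ps) = Premise-⊆ X⊆Y p , Premises-⊆ L K-⊆ (∷⁺ʳ φ X⊆Y) ps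

  Premises-map : ∀ L {K K′ : Ctx → Set} → (∀ {Z} → X ⊆ Z → K Z → K′ Z) →
                 Premises X L K → Premises X L K′
  Premises-map []            f k        = f ⊆-refl k
  Premises-map ((φ , ψ) ∷ L) f (p , ps) = p , Premises-map L (f ∘ ⊆-trans (xs⊆x∷xs _ φ)) ps

  Premises-++⁺ : ∀ L₁ {L₂ K} → Premises X L₁ (λ Z → Premises Z L₂ K) → Premises X (L₁ ++ L₂) K
  Premises-++⁺ []             ps       = ps
  Premises-++⁺ ((φ , ψ) ∷ L₁) (p , ps) = p , Premises-++⁺ L₁ ps

  Premises-++⁻ : ∀ L₁ {L₂ K} → Premises X (L₁ ++ L₂) K → Premises X L₁ (λ Z → Premises Z L₂ K)
  Premises-++⁻ []             ps       = ps
  Premises-++⁻ ((φ , ψ) ∷ L₁) (p , ps) = p , Premises-++⁻ L₁ ps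

  Premises⇒vec : ∀ L {ψ} → X ⊆ Y → Premises X L (Premise ψ) →
                 (i : Fin (suc (length L))) →
                 Premise (snoc (ψsOf L) ψ i) (prefix (φsOf L) (toℕ i) ++ Y)
  Premises⇒vec []            X⊆Y p        zero    = Premise-⊆ X⊆Y p
  Premises⇒vec ((φ , ψ) ∷ L) X⊆Y (p , ps) zero    = Premise-⊆ X⊆Y p
  Premises⇒vec {Y = Y} ((φ , ψ) ∷ L) X⊆Y (p , ps) (suc i) =
    Premise-⊆ (⊆-reflexive-↭ (shift φ (prefix (φsOf L) (toℕ i)) Y))
              (Premises⇒vec L (∷⁺ʳ φ X⊆Y) ps i)

  vec⇒Premises : ∀ {m} (φs ψs : Vector Fm m) {ψ} → Y ⊆ X →
                 ((i : Fin (suc m)) → Premise (snoc ψs ψ i) (prefix φs (toℕ i) ++ Y)) →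
                 Premises X (toList (zip φs ψs)) (Premise ψ)
  vec⇒Premises {m = zero}  φs ψs Y⊆X ps = Premise-⊆ Y⊆X (ps zero)
  vec⇒Premises {Y = Y} {m = suc m} φs ψs Y⊆X ps =
    Premise-⊆ Y⊆X (ps zero) ,
    vec⇒Premises (Vec.tail φs) (Vec.tail ψs) (∷⁺ʳ (φs zero) Y⊆X) (λ i →
      Premise-⊆ (⊆-reflexive-↭ (↭-sym (shift (φs zero) (prefix (Vec.tail φs) (toℕ i)) Y)))
                (ps (suc i)))

  Premises-dedup : ∀ L {K} → K Respects _⊆_ → Premises X L K →
                   ∃ λ L′ → L′ ⊆ L × Fresh X L′ × Premises X L′ K
  Premises-dedup []            K-⊆ k = [] , (λ ()) , tt , k
  Premises-dedup {X} ((φ , ψ) ∷ L) K-⊆ (p , ps) with φ ∈? X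
  ... | yes φ∈X with L′ , L′⊆L , fresh , ps′ ←
                     Premises-dedup L K-⊆ (Premises-⊆ L K-⊆ (∈-∷⁺ʳ φ∈X ⊆-refl) ps) =
    L′ , there ∘ L′⊆L , fresh , ps′
  ... | no φ∉X with L′ , L′⊆L , fresh , ps′ ← Premises-dedup L K-⊆ ps =
    (φ , ψ) ∷ L′ , ∷⁺ʳ _ L′⊆L , (φ∉X , fresh) , (p , ps′)

  -- ▷_IK4 takes its boxes as a sub-multiset of the antecedent, so L is deduplicated first.
  rhd-⊆ : ∀ L {ψ φ} → boxesᴸ L ⊆ Γ → ψ ▷ φ ∈ Δ → Premises (φ ∷ []) L (Premise ψ) → CutFree S Γ Δ
  rhd-⊆ {Γ} L {ψ} {φ} L⊆Γ ψ▷φ∈Δ ps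
    with L′ , L′⊆L , fresh , ps′ ← Premises-dedup L Premise-⊆ ps
    with Γ′ , Γ↭ ← Unique∧⊆⇒↭++ (Unique.map⁺ uncurry-▷-injective (Fresh⇒Unique L′ fresh))
                                (⊆-trans (map⁺ _ L′⊆L) L⊆Γ)
    with Δ′ , Δ↭ ← ∈⇒↭ ψ▷φ∈Δ =
    rhd (length L′) (φsOf L′) (ψsOf L′) ψ φ Γ′ Δ′
        (subst (λ B → Γ ↭ B ++ Γ′) (sym (boxes-fromList L′)) Γ↭) Δ↭
        (state ∘ Premises⇒vec L′ ⊆-refl ps′)

  Premises-⊥ : ∀ X {Z K} → (∀ {Z′} → Z ⊆ Z′ → X ⊆ Z′ → K Z′) → Premises Z (map (_, bot) X) K
  Premises-⊥ []      k = k ⊆-refl (λ ())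
  Premises-⊥ (x ∷ X) k = botL _ refl , Premises-⊥ X (λ Z⊆Z′ X⊆Z′ →
    k (⊆-trans (xs⊆x∷xs _ x) Z⊆Z′) (∈-∷⁺ʳ (Z⊆Z′ (here refl)) X⊆Z′))

  Premise-cut : ∀ {b} → Premise ψ (b ∷ Y) → Premise b X → Premise ψ (X ++ Y)
  Premise-cut {ψ} {Y} {X} {b} ψ/bY b/X = cut b (cut (b ▷ bot) b▷⊥ ψ/bY′) b/X′
    where
      W : Ctx
      W = X ++ Y
      b▷⊥ : Local S (ψ ∷ W ▷⊥) ((W ++ b ∷ []) ++ (b ▷ bot) ∷ [])
      b▷⊥ = toLocal (rhd-⊆ (map (_, bot) X)
                      (there ∘ map⁺ _ (xs⊆xs++ys X Y) ∘ ⊆-reflexive (sym (map-∘ X)))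
                      (∈-++⁺ʳ (W ++ b ∷ []) (here refl))
                      (Premises-⊥ X (λ _ X⊆Z → Premise-⊆ X⊆Z b/X)))
      ψ/bY′ : Local S ((b ▷ bot) ∷ ψ ∷ W ▷⊥) (W ++ b ∷ [])
      ψ/bY′ = Local-⊆ (λ { (here refl)         → there (here refl)
                         ; (there (here refl)) → here refl
                         ; (there (there k))   → there (there (map⁺ _ (xs⊆ys++xs Y X) k)) })
                      (∈-∷⁺ʳ (∈-++⁺ʳ W (here refl)) (⊆-trans (xs⊆ys++xs Y X) (xs⊆xs++ys W _)))
                      ψ/bY
      b/X′ : Local S (b ∷ ψ ∷ W ▷⊥) W
      b/X′ = Local-⊆ (∷⁺ʳ b (there ∘ map⁺ _ (xs⊆xs++ys X Y))) (xs⊆xs++ys X Y) b/X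

  Premises-cut : ∀ L {b} → Premise b X → Premises (b ∷ Y) L (Premise ψ) →
                 Premises (X ++ Y) L (Premise ψ)
  Premises-cut []             b/X p        = Premise-cut p b/X
  Premises-cut {X} {Y} ((φ , _) ∷ L) {b} b/X (p , ps) =
    Premise-cut p b/X ,
    Premises-⊆ L Premise-⊆ (⊆-reflexive-↭ (shift φ X Y))
      (Premises-cut L b/X (Premises-⊆ L Premise-⊆ (⊆-reflexive-↭ (swap φ b refl)) ps))

  Premises-merge : ∀ Lₗ Lₘ {Lᵣ a b ψ} → Premises (b ∷ []) Lₘ (Premise a) →
                   Premises X (Lₗ ++ (a , b) ∷ Lᵣ) (Premise ψ) →
                   Premises X (Lₗ ++ Lₘ ++ Lᵣ) (Premise ψ)
  Premises-merge {X} Lₗ Lₘ {Lᵣ} {a} {b} {ψ} inner outer =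
    Premises-++⁺ Lₗ (Premises-map Lₗ splice (Premises-++⁻ Lₗ outer))
    where
      splice : ∀ {Z} → X ⊆ Z → Premises Z ((a , b) ∷ Lᵣ) (Premise ψ) →
               Premises Z (Lₘ ++ Lᵣ) (Premise ψ)
      splice {Z} _ (b/Z , ps) = Premises-++⁺ Lₘ
        (Premises-map Lₘ
          (λ Z⊆V a/V → Premises-⊆ Lᵣ Premise-⊆ (++-⊆ ⊆-refl Z⊆V) (Premises-cut Lᵣ a/V ps))
          (Premises-⊆ Lₘ Premise-⊆ (⊆-reflexive (++-identityʳ Z)) (Premises-cut Lₘ b/Z inner)))

  contract-var : ∀ {p} → CutFree S Γ₁ Δ → Γ₁ ↭ var p ∷ Γ → var p ∈ Γ → CutFree S Γ Δ
  contract-var (ax q Γ′ Δ′ g h) r p∈Γ with ∷↭∷⁻ (↭-sym g ⨾ r)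
  ... | inj₁ (refl , _) with Γ″ , s ← ∈⇒↭ p∈Γ = ax q Γ″ Δ′ s h
  ... | inj₂ (K , s , _) = ax q K Δ′ s h
  contract-var (botL Γ′ g) r p∈Γ with K , s , _ ← ∷↭∷⁻-≢ (λ ()) (↭-sym g ⨾ r) = botL K s
  contract-var (botR Δ′ h d) r p∈Γ = botR Δ′ h (contract-var d r p∈Γ)
  contract-var {p = p} (impL φ ψ Γ′ g d e) r p∈Γ
    with K , s , s′ ← ∷↭∷⁻-≢ (λ ()) (↭-sym g ⨾ r) =
    impL φ ψ K s (contract-var d s′ p∈K) (contract-var e (prep ψ s′ ⨾ swap ψ _ refl) (there p∈K))
    where
      p∈K : var p ∈ K
      p∈K = Any.tail (λ ()) (∈-resp-↭ s p∈Γ)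
  contract-var (impR φ ψ Δ′ h d) r p∈Γ =
    impR φ ψ Δ′ h (contract-var d (prep φ r ⨾ swap φ _ refl) (there p∈Γ))
  contract-var (rhd m φs ψs ψm φ Γ′ Δ′ g h prem) r p∈Γ
    with K , _ , s ← ++↭∷⁻ (boxes φs ψs) (∈boxes⇒IsBox φs ψs) (↭-sym g ⨾ r) =
    rhd m φs ψs ψm φ K Δ′ s h prem

  -- The left ▷_IK4 instance concludes a ▷ b from the boxes Lₘ; wherever a ▷ b is a box of an
  -- ▷_IK4 instance on the right, the two instances are merged.
  cut-▷ : ∀ Lₘ {a b} → boxesᴸ Lₘ ⊆ Γ → Premises (b ∷ []) Lₘ (Premise a) →
          CutFree S Γ₁ Δ → Γ₁ ↭ (a ▷ b) ∷ Γ → CutFree S Γ Δ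
  cut-▷ Lₘ Lₘ⊆Γ inner (ax q Γ′ Δ′ g h) r
    with K , s , _ ← ∷↭∷⁻-≢ (λ ()) (↭-sym g ⨾ r) = ax q K Δ′ s h
  cut-▷ Lₘ Lₘ⊆Γ inner (botL Γ′ g) r with K , s , _ ← ∷↭∷⁻-≢ (λ ()) (↭-sym g ⨾ r) = botL K s
  cut-▷ Lₘ Lₘ⊆Γ inner (botR Δ′ h d) r = botR Δ′ h (cut-▷ Lₘ Lₘ⊆Γ inner d r)
  cut-▷ Lₘ Lₘ⊆Γ inner (impL φ ψ Γ′ g d e) r with K , s , s′ ← ∷↭∷⁻-≢ (λ ()) (↭-sym g ⨾ r) =
    impL φ ψ K s (cut-▷ Lₘ Lₘ⊆K inner d s′)
                 (cut-▷ Lₘ (there ∘ Lₘ⊆K) inner e (prep ψ s′ ⨾ swap ψ _ refl))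
    where
      Lₘ⊆K : boxesᴸ Lₘ ⊆ K
      Lₘ⊆K x∈ = Any.tail (λ eq → subst IsBox eq (∈boxesᴸ⇒IsBox Lₘ x∈))
                         (∈-resp-↭ s (Lₘ⊆Γ x∈))
  cut-▷ Lₘ Lₘ⊆Γ inner (impR φ ψ Δ′ h d) r =
    impR φ ψ Δ′ h (cut-▷ Lₘ (there ∘ Lₘ⊆Γ) inner d (prep φ r ⨾ swap φ _ refl))
  cut-▷ Lₘ {a} {b} Lₘ⊆Γ inner (rhd m φs ψs ψm φ Γ′ Δ′ g h prem) r
    with (a ▷ b) ∈? boxes φs ψs
  ... | no a▷b∉ with K , _ , s ← ++↭∷⁻ (boxes φs ψs) a▷b∉ (↭-sym g ⨾ r) =
    rhd m φs ψs ψm φ K Δ′ s h prem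
  ... | yes a▷b∈
    with Lₗ , Lᵣ , eq ← ∈boxesᴸ⇒∃++ _ (subst (_ ∈_) (boxes≡boxesᴸ-zip φs ψs) a▷b∈) =
    rhd-⊆ (Lₗ ++ Lₘ ++ Lᵣ)
          (merged-boxes-⊆ Lₗ Lₘ Lᵣ Lₘ⊆Γ (↭-sym r ⨾ g ⨾ ↭-reflexive boxes-split))
          (↭∷⇒∈ h) (Premises-merge Lₗ Lₘ inner outer)
    where
      boxes-split : boxes φs ψs ++ Γ′ ≡ boxesᴸ (Lₗ ++ (a , b) ∷ Lᵣ) ++ Γ′
      boxes-split = cong (_++ Γ′) (trans (boxes≡boxesᴸ-zip φs ψs) (cong boxesᴸ eq))
      outer : Premises (φ ∷ []) (Lₗ ++ (a , b) ∷ Lᵣ) (Premise ψm)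
      outer = subst (λ L → Premises (φ ∷ []) L (Premise ψm)) eq
                    (vec⇒Premises φs ψs ⊆-refl (expand ∘ prem))

  CutAdmissible : Fm → Set
  CutAdmissible χ = ∀ {Γ Δ Γχ Δχ} → CutFree S Γ Δχ → Δχ ↭ χ ∷ Δ →
                    CutFree S Γχ Δ → Γχ ↭ χ ∷ Γ → CutFree S Γ Δ

  cut-admissible : ∀ χ → CutAdmissible χ
  cut-admissible χ (ax p Γ′ Δ′ g h) r e s with ∷↭∷⁻ (↭-sym h ⨾ r)
  ... | inj₁ (refl , _)   = contract-var e s (↭∷⇒∈ g)
  ... | inj₂ (K , r′ , _) = ax p Γ′ K g r′
  cut-admissible χ (botL Γ′ g) r e s = botL Γ′ g
  cut-admissible χ (botR Δ′ h d) r e s with ∷↭∷⁻ (↭-sym h ⨾ r)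
  ... | inj₁ (refl , r′)    = CutFree-↭ refl r′ d
  ... | inj₂ (K , r′ , r″) = botR K r′ (cut-admissible χ d r″ (CutFree-botR⁻ e r′) s)
  cut-admissible χ (impL φ ψ Γ′ g d₁ d₂) r e s
    with e₁ , e₂ ← CutFree-impL⁻ e (s ⨾ prep χ g ⨾ swap χ _ refl) =
    impL φ ψ Γ′ g (cut-admissible χ d₁ (++⁺ʳ (φ ∷ []) r) e₁ refl)
                  (cut-admissible χ d₂ r e₂ (swap ψ χ refl))
  cut-admissible χ {Γ} {Δ} (impR φ ψ Δ′ h d) r e s with ∷↭∷⁻ (↭-sym h ⨾ r)
  ... | inj₁ (refl , r′) with e₁ , e₂ ← CutFree-impL⁻ e s =
    cut-admissible ψ
      (cut-admissible φ (CutFree-weaken [] (ψ ∷ []) (↭-reflexive (++-identityʳ Γ)) refl e₁)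
         (∷ʳ-++-comm Δ φ (ψ ∷ []) ⨾ ++[]↭∷ (Δ ++ ψ ∷ []) φ
                                  ⨾ prep φ (++⁺ʳ (ψ ∷ []) (↭-sym r′)))
         d refl)
      (++[]↭∷ Δ′ ψ ⨾ prep ψ r′) e₂ refl
  ... | inj₂ (K , r′ , r″) =
    impR φ ψ K r′ (cut-admissible χ d (++⁺ʳ (ψ ∷ []) r″)
                                    (CutFree-impR⁻ e r′) (prep φ s ⨾ swap φ χ refl))
  cut-admissible χ (rhd m φs ψs ψm φ Γ′ Δ′ g h prem) r e s with ∷↭∷⁻ (↭-sym h ⨾ r)
  ... | inj₁ (refl , _) =
    cut-▷ (toList (zip φs ψs))
      (⊆-reflexive-↭ (↭-sym g) ∘ xs⊆xs++ys _ Γ′ ∘ ⊆-reflexive (sym (boxes≡boxesᴸ-zip φs ψs)))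
      (vec⇒Premises φs ψs ⊆-refl (expand ∘ prem)) e s
  ... | inj₂ (K , r′ , _) = rhd m φs ψs ψm φ Γ′ K g r′ prem

-- A state of the new proof is a state of one of the two given proofs or an arbitrary local
-- derivation; the latter kind carries the cuts left above progress steps.
data Joint (S T : Ctx → Ctx → Set) (Γ Δ : Ctx) : Set where
  new   : Local (Joint S T) Γ Δ → Joint S T Γ Δ
  left  : S Γ Δ → Joint S T Γ Δ
  right : T Γ Δ → Joint S T Γ Δ

Joint-unfold : (∀ {Γ Δ} → S Γ Δ → Local S Γ Δ) → (∀ {Γ Δ} → T Γ Δ → Local T Γ Δ) →
               Joint S T Γ Δ → Local (Joint S T) Γ Δ
Joint-unfold unfoldS unfoldT (new d)   = d
Joint-unfold unfoldS unfoldT (left s)  = mapLocal left (unfoldS s)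
Joint-unfold unfoldS unfoldT (right t) = mapLocal right (unfoldT t)

mainTheorem7 : (Γ Δ : Ctx) (χ : Fm) →
    (π : Proof Γ (Δ ++ χ ∷ [])) → LocalCutFree π →
    (τ : Proof (χ ∷ Γ) Δ) → LocalCutFree τ →
    Σ (Proof Γ Δ) LocalCutFree
mainTheorem7 Γ Δ χ π π-cutFree τ τ-cutFree = proof , toLocal-cutFree d
  where
    St : Ctx → Ctx → Set
    St = Joint (State π) (State τ)
    unfold′ : ∀ {Γ Δ} → St Γ Δ → Local St Γ Δ
    unfold′ = Joint-unfold (unfold π) (unfold τ)
    d : CutFree St Γ Δ
    d = cut-admissible new unfold′ χ
          (fromLocal left (mainLocal π) π-cutFree) (++[]↭∷ Δ χ)
          (fromLocal right (mainLocal τ) τ-cutFree) refl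
    proof : Proof Γ Δ
    proof = record { State = St ; unfold = unfold′ ; start = new (toLocal d) }
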